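{- Let $n,k$ be integers with $2\le k\le n-1$, and let $(\mathbf a^{(1)},\mathbf a^{(2)},\dots,\mathbf a^{(k)})$ be a closed $k$-walk in $G(n)$ with $\mathbf a^{(i)}=a^{(i)}_1a^{(i)}_2\cdots a^{(i)}_n$. Then \[\mathrm{st}\bigl(a^{(2)}_k\cdots a^{(2)}_n\bigr)=\mathrm{st}\bigl(a^{(1)}_1\cdots a^{(1)}_{n-k+1}\bigr).\]
   Context: For a sequence of distinct integers $c_1\cdots c_t$, $\mathrm{st}(c_1\cdots c_t)$ is the unique permutation $b_1\cdots b_t$ of $\{1,\dots,t\}$ with $b_i<b_j$ iff $c_i<c_j$. $G(n)$ is the directed multigraph whose vertices are the permutations of $\{1,\dots,n\}$ (one-line notation) and whose edges are the permutations $c_1\cdots c_{n+1}$ of $\{1,\dots,n+1\}$, the edge $c_1\cdots c_{n+1}$ going from $\mathrm{st}(c_1\cdots c_n)$ to $\mathrm{st}(c_2\cdots c_{n+1})$; so there is an edge from $a_1\cdots a_n$ to $b_1\cdots b_n$ iff $\mathrm{st}(a_2\cdots a_n)=\mathrm{st}(b_1\cdots b_{n-1})$. A closed $k$-walk $(v_1,\dots,v_k)$ is a sequence of vertices together with edges $e_i$ from $v_i$ to $v_{i+1}$ for $i<k$ and $e_k$ from $v_k$ to $v_1$. -}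

module Defs where

open import Data.Nat using (ℕ; zero; suc; _+_; _∸_; _≤_; _<_; _<?_)
open import Data.List using (List; []; _∷_; length; map; filter; take; drop)
open import Data.List.Relation.Unary.All using (All)
open import Data.List.Relation.Unary.Unique.Propositional using (Unique)
open import Data.Product using (Σ; _×_)
open import Relation.Binary.PropositionalEquality using (_≡_)

countLess : List ℕ → ℕ → ℕ
countLess c x = length (filter (λ y → y <? x) c)

-- standardization: st(c)_i = 1 + #{ j : c_j < c_i }.  For a sequence of
-- distinct integers this is the unique permutation b of {1..t} with
-- b_i < b_j iff c_i < c_j.
st : List ℕ → List ℕ
st c = map (λ x → suc (countLess c x)) c

IsPerm : ℕ → List ℕ → Set
IsPerm n w = (length w ≡ n) × Unique w × All (λ x → (1 ≤ x) × (x ≤ n)) w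

Edge : ℕ → List ℕ → List ℕ → Set
Edge n a b = Σ (List ℕ) (λ c → IsPerm (suc n) c × (st (take n c) ≡ a) × (st (drop 1 c) ≡ b))

-- (v 1, …, v k) is a closed k-walk in G(n)  (1-indexed; values of v
-- outside 1..k are irrelevant)
ClosedWalk : ℕ → ℕ → (ℕ → List ℕ) → Set
ClosedWalk n k v =
  ((i : ℕ) → 1 ≤ i → i ≤ k → IsPerm n (v i))
  × ((i : ℕ) → 1 ≤ i → i < k → Edge n (v i) (v (suc i)))
  × Edge n (v k) (v 1)

-- Standardisation commutes with taking and dropping: st (take i (st c)) = st (take i c) and
-- likewise for drop, because the rank map x ↦ 1 + #{y ∈ c ∣ y < x} is strictly increasing on c
-- and st is invariant under strictly increasing relabelling.  Hence along an edge c from a to b,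
-- st (drop 1 (take p a)) = st (take (p − 1) b): an edge shifts a pattern one place to the left.
-- Starting from a⁽²⁾ and following the k − 2 edges to a⁽ᵏ⁾ and then the closing edge to a⁽¹⁾,
-- the pattern of a⁽²⁾ with its first k − 1 entries removed is carried to the pattern of the
-- first n − k + 1 entries of a⁽¹⁾.  Since st is defined by counting for arbitrary lists, no
-- distinctness is needed: of the permutation hypotheses only length a⁽²⁾ = n is used.
module Submission where

open import Defs
open import Data.Nat using (ℕ; _≤_; _∸_; _+_)
open import Data.List using (List; take; drop)
open import Relation.Binary.PropositionalEquality using (_≡_)

open import Data.Nat using (zero; suc; pred; _⊓_; _<_; _<?_; z≤n; s≤s)
open import Data.Nat.Properties
  using (≤-refl; ≤-reflexive; ≤-trans; <-trans; <-≤-trans; <⇒≤; <-irrefl; <-asym; <-cmp;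
         m≤n⇒m≤1+n; m∸n≤m; m<n⇒m<1+n; m≤n⇒m⊓n≡m; pred[m∸n]≡m∸[1+n]; +-comm)
open import Data.List using ([]; _∷_; map; length)
open import Data.List.Properties
  using (take-map; drop-map; take-all; take-take; drop-drop; take-[]; filter-accept; filter-reject;
         map-∘; map-cong-local)
open import Data.List.Membership.Propositional using (_∈_)
open import Data.List.Relation.Unary.Any using (here; there)
import Data.List.Relation.Unary.All as All
open import Data.List.Relation.Binary.Subset.Propositional using (_⊆_)
import Data.List.Relation.Binary.Sublist.Propositional.Properties as Sublist
open import Data.Product using (_,_; proj₁)
open import Data.Empty using (⊥-elim)
open import Function using (_∘_; id)
open import Relation.Nullary using (yes; no; ¬_)
open import Relation.Binary.Definitions using (tri<; tri≈; tri>)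
open import Relation.Binary.PropositionalEquality using (refl; sym; trans; cong; module ≡-Reasoning)

take⊆ : ∀ {A : Set} i (c : List A) → take i c ⊆ c
take⊆ i c = Sublist.Any-resp-⊆ (Sublist.take-⊆ i c)

drop⊆ : ∀ {A : Set} i (c : List A) → drop i c ⊆ c
drop⊆ i c = Sublist.Any-resp-⊆ (Sublist.drop-⊆ i c)

drop-suc : ∀ {A : Set} m (xs : List A) → drop (suc m) xs ≡ drop 1 (drop m xs)
drop-suc m xs = trans (cong (λ i → drop i xs) (+-comm 1 m)) (sym (drop-drop m 1 xs))

drop-1-take : ∀ {A : Set} p (xs : List A) → drop 1 (take p xs) ≡ take (pred p) (drop 1 xs)
drop-1-take zero    xs       = refl
drop-1-take (suc p) []       = sym (take-[] p)
drop-1-take (suc p) (x ∷ xs) = refl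

m∸n≡m∸[1+n]+1 : ∀ {m n} → n < m → m ∸ n ≡ m ∸ suc n + 1
m∸n≡m∸[1+n]+1 {suc m} {zero}  _         = +-comm 1 m
m∸n≡m∸[1+n]+1 {suc m} {suc n} (s≤s n<m) = m∸n≡m∸[1+n]+1 n<m

countLess-∷-< : ∀ {z x} c → z < x → countLess (z ∷ c) x ≡ suc (countLess c x)
countLess-∷-< {x = x} c z<x = cong length (filter-accept (_<? x) z<x)

countLess-∷-≮ : ∀ {z x} c → ¬ z < x → countLess (z ∷ c) x ≡ countLess c x
countLess-∷-≮ {x = x} c z≮x = cong length (filter-reject (_<? x) z≮x)

countLess-mono-≤ : ∀ c {x y} → x ≤ y → countLess c x ≤ countLess c y
countLess-mono-≤ []      _   = z≤n
countLess-mono-≤ (z ∷ c) {x} {y} x≤y with z <? x | z <? y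
... | yes z<x | yes z<y rewrite countLess-∷-< c z<x | countLess-∷-< c z<y = s≤s (countLess-mono-≤ c x≤y)
... | yes z<x | no  z≮y = ⊥-elim (z≮y (<-≤-trans z<x x≤y))
... | no  z≮x | yes z<y rewrite countLess-∷-≮ c z≮x | countLess-∷-< c z<y = m≤n⇒m≤1+n (countLess-mono-≤ c x≤y)
... | no  z≮x | no  z≮y rewrite countLess-∷-≮ c z≮x | countLess-∷-≮ c z≮y = countLess-mono-≤ c x≤y

countLess-mono-< : ∀ c {x y} → x ∈ c → x < y → countLess c x < countLess c y
countLess-mono-< (z ∷ c) {x} {y} (here refl) x<y with z <? x | z <? y
... | yes z<z | _       = ⊥-elim (<-irrefl refl z<z)
... | no  z≮x | yes z<y rewrite countLess-∷-≮ c z≮x | countLess-∷-< c z<y = s≤s (countLess-mono-≤ c (<⇒≤ x<y))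
... | no  _   | no  z≮y = ⊥-elim (z≮y x<y)
countLess-mono-< (z ∷ c) {x} {y} (there x∈c) x<y with z <? x | z <? y
... | yes z<x | yes z<y rewrite countLess-∷-< c z<x | countLess-∷-< c z<y = s≤s (countLess-mono-< c x∈c x<y)
... | yes z<x | no  z≮y = ⊥-elim (z≮y (<-trans z<x x<y))
... | no  z≮x | yes z<y rewrite countLess-∷-≮ c z≮x | countLess-∷-< c z<y = m≤n⇒m≤1+n (countLess-mono-< c x∈c x<y)
... | no  z≮x | no  z≮y rewrite countLess-∷-≮ c z≮x | countLess-∷-≮ c z≮y = countLess-mono-< c x∈c x<y

StrictlyIncreasingOn : List ℕ → (ℕ → ℕ) → Set
StrictlyIncreasingOn d g = ∀ {x y} → x ∈ d → y ∈ d → x < y → g x < g y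

strictlyIncreasing-reflects-< : ∀ {d g} → StrictlyIncreasingOn d g →
  ∀ {x y} → x ∈ d → y ∈ d → g x < g y → x < y
strictlyIncreasing-reflects-< inc {x} {y} x∈d y∈d gx<gy with <-cmp x y
... | tri< x<y _ _ = x<y
... | tri≈ _ refl _ = ⊥-elim (<-irrefl refl gx<gy)
... | tri> _ _ y<x = ⊥-elim (<-asym gx<gy (inc y∈d x∈d y<x))

rank : List ℕ → ℕ → ℕ
rank c x = suc (countLess c x)

rank-strictlyIncreasing : ∀ c → StrictlyIncreasingOn c (rank c)
rank-strictlyIncreasing c x∈c _ x<y = s≤s (countLess-mono-< c x∈c x<y)

countLess-map : ∀ {d g} → StrictlyIncreasingOn d g →
  ∀ e → e ⊆ d → ∀ {x} → x ∈ d → countLess (map g e) (g x) ≡ countLess e x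
countLess-map inc []      _   _   = refl
countLess-map {g = g} inc (y ∷ e) e⊆d {x} x∈d with y <? x
... | yes y<x = trans (countLess-∷-< (map g e) (inc (e⊆d (here refl)) x∈d y<x))
                  (trans (cong suc (countLess-map inc e (e⊆d ∘ there) x∈d))
                         (sym (countLess-∷-< e y<x)))
... | no  y≮x = trans (countLess-∷-≮ (map g e) (y≮x ∘ strictlyIncreasing-reflects-< inc (e⊆d (here refl)) x∈d))
                  (trans (countLess-map inc e (e⊆d ∘ there) x∈d)
                         (sym (countLess-∷-≮ e y≮x)))

st-map : ∀ {d g} → StrictlyIncreasingOn d g → st (map g d) ≡ st d
st-map {d} {g} inc = begin
  map (rank (map g d)) (map g d) ≡⟨ sym (map-∘ d) ⟩
  map (rank (map g d) ∘ g) d     ≡⟨ map-cong-local (All.tabulate λ x∈d → cong suc (countLess-map inc d id x∈d)) ⟩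
  map (rank d) d                 ∎
  where open ≡-Reasoning

st-map-rank : ∀ c {d} → d ⊆ c → st (map (rank c) d) ≡ st d
st-map-rank c d⊆c = st-map λ x∈d y∈d → rank-strictlyIncreasing c (d⊆c x∈d) (d⊆c y∈d)

st-take-st : ∀ i c → st (take i (st c)) ≡ st (take i c)
st-take-st i c = trans (cong st (take-map i c)) (st-map-rank c (take⊆ i c))

st-drop-st : ∀ i c → st (drop i (st c)) ≡ st (drop i c)
st-drop-st i c = trans (cong st (drop-map i c)) (st-map-rank c (drop⊆ i c))

st-drop-cong : ∀ i {xs ys} → st xs ≡ st ys → st (drop i xs) ≡ st (drop i ys)
st-drop-cong i {xs} {ys} eq = begin
  st (drop i xs)      ≡⟨ sym (st-drop-st i xs) ⟩
  st (drop i (st xs)) ≡⟨ cong (λ zs → st (drop i zs)) eq ⟩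
  st (drop i (st ys)) ≡⟨ st-drop-st i ys ⟩
  st (drop i ys)      ∎
  where open ≡-Reasoning

edge-shift : ∀ {n a b} → Edge n a b → ∀ {p} → p ≤ n →
  st (drop 1 (take p a)) ≡ st (take (pred p) b)
edge-shift {n} {a} {b} (c , _ , st-init≡a , st-tail≡b) {p} p≤n = begin
  st (drop 1 (take p a))                ≡⟨ cong (λ zs → st (drop 1 (take p zs))) (sym st-init≡a) ⟩
  st (drop 1 (take p (st (take n c))))  ≡⟨ st-drop-cong 1 (st-take-st p (take n c)) ⟩
  st (drop 1 (take p (take n c)))       ≡⟨ cong (λ zs → st (drop 1 zs)) (take-take p n c) ⟩
  st (drop 1 (take (p ⊓ n) c))          ≡⟨ cong (λ i → st (drop 1 (take i c))) (m≤n⇒m⊓n≡m p≤n) ⟩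
  st (drop 1 (take p c))                ≡⟨ cong st (drop-1-take p c) ⟩
  st (take (pred p) (drop 1 c))         ≡⟨ sym (st-take-st (pred p) (drop 1 c)) ⟩
  st (take (pred p) (st (drop 1 c)))    ≡⟨ cong (λ zs → st (take (pred p) zs)) st-tail≡b ⟩
  st (take (pred p) b)                  ∎
  where open ≡-Reasoning

edge-step : ∀ {n a b} → Edge n a b → ∀ {p} → p ≤ n → ∀ {xs} →
  st xs ≡ st (take p a) → st (drop 1 xs) ≡ st (take (pred p) b)
edge-step e p≤n eq = trans (st-drop-cong 1 eq) (edge-shift e p≤n)

path-step : ∀ {n} m (u : ℕ → List ℕ) → (∀ j → j < m → Edge n (u j) (u (suc j))) →
  ∀ {p} → p ≤ n → ∀ {xs} → st xs ≡ st (take p (u 0)) → st (drop m xs) ≡ st (take (p ∸ m) (u m))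
path-step zero    u edges p≤n eq = eq
path-step (suc m) u edges {p} p≤n {xs} eq = begin
  st (drop (suc m) xs)                ≡⟨ cong st (drop-suc m xs) ⟩
  st (drop 1 (drop m xs))             ≡⟨ edge-step (edges m ≤-refl) (≤-trans (m∸n≤m p m) p≤n) walked ⟩
  st (take (pred (p ∸ m)) (u (suc m))) ≡⟨ cong (λ i → st (take i (u (suc m)))) (pred[m∸n]≡m∸[1+n] p m) ⟩
  st (take (p ∸ suc m) (u (suc m)))   ∎
  where
  open ≡-Reasoning
  walked : st (drop m xs) ≡ st (take (p ∸ m) (u m))
  walked = path-step m u (λ j j<m → edges j (m<n⇒m<1+n j<m)) p≤n eq

corollary3p2 : (n k : ℕ) → 2 ≤ k → k ≤ n ∸ 1 → (v : ℕ → List ℕ) → ClosedWalk n k v →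
    st (drop (k ∸ 1) (v 2)) ≡ st (take (n ∸ k + 1) (v 1))
corollary3p2 n (suc (suc j)) (s≤s (s≤s _)) k≤n∸1 v (perms , edges , closing) = begin
  st (drop (suc j) (v 2))               ≡⟨ cong st (drop-suc j (v 2)) ⟩
  st (drop 1 (drop j (v 2)))            ≡⟨ edge-step closing (m∸n≤m n j) along-walk ⟩
  st (take (pred (n ∸ j)) (v 1))        ≡⟨ cong (λ i → st (take i (v 1))) lengths ⟩
  st (take (n ∸ suc (suc j) + 1) (v 1)) ∎
  where
  open ≡-Reasoning
  v2-whole : st (v 2) ≡ st (take n (v 2))
  v2-whole = cong st (sym (take-all n (v 2) (≤-reflexive (proj₁ (perms 2 (s≤s z≤n) (s≤s (s≤s z≤n)))))))
  along-walk : st (drop j (v 2)) ≡ st (take (n ∸ j) (v (suc (suc j))))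
  along-walk = path-step j (λ i → v (2 + i)) (λ i i<j → edges (2 + i) (s≤s z≤n) (s≤s (s≤s i<j))) ≤-refl v2-whole
  lengths : pred (n ∸ j) ≡ n ∸ suc (suc j) + 1
  lengths = trans (pred[m∸n]≡m∸[1+n] n j) (m∸n≡m∸[1+n]+1 (≤-trans k≤n∸1 (m∸n≤m n 1)))
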